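{- Let $(n,m)$ be integers with $n\geq 4$ and $n\leq m\leq\binom{n}{2}$, and let $G\in T_{n,m}$. Then $F_1(G)\leq b(n,m)$, with equality if and only if $G$ has exactly $b(n,m)$ bridges and each of them is an $s$-$t$ cut.
   Context: A two-terminal graph is a connected simple graph with two distinct distinguished vertices $s,t$ (terminals); $T_{n,m}$ is the set of nonisomorphic connected simple two-terminal graphs (isomorphisms preserving the terminal set) with $n$ vertices and $m$ edges. A split subgraph of $G$ is a spanning subgraph with exactly two connected components, one containing $s$ and the other $t$; $F_i(G)$ is the number of split subgraphs of $G$ with exactly $m-i$ edges. A bridge is an edge whose deletion disconnects the graph; an edge $e$ is an $s$-$t$ cut if $G-e$ has no path joining $s$ and $t$. $b(n,m)$ is the maximum number of bridges of a connected simple graph with $n$ vertices and $m$ edges. -}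

module Defs where

open import Data.Bool using (Bool; true; false; _∧_; _∨_; not)
open import Data.Nat using (ℕ; zero; suc; _≤_; _<ᵇ_)
open import Data.Fin using (Fin; toℕ; _≟_)
open import Data.List using (List; []; _∷_; allFin; filterᵇ; length; concatMap; map)
open import Data.Bool.ListAction using (all; any)
open import Data.Product using (_×_; _,_; Σ; ∃)
open import Relation.Nullary.Decidable using (⌊_⌋)
open import Relation.Binary.PropositionalEquality using (_≡_)

Adj : ℕ → Set
Adj n = Fin n → Fin n → Bool

record SimpleGraph (n : ℕ) : Set where
  field
    adj    : Adj n
    sym    : ∀ i j → adj i j ≡ adj j i
    irrefl : ∀ i → adj i i ≡ false
open SimpleGraph public

_==_ : {n : ℕ} → Fin n → Fin n → Bool
i == j = ⌊ i ≟ j ⌋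

-- unordered pairs {i,j}, represented as (i , j) with i < j
Edge : ℕ → Set
Edge n = Fin n × Fin n

pairs : (n : ℕ) → List (Edge n)
pairs n = concatMap (λ i → map (λ j → (i , j)) (filterᵇ (λ j → toℕ i <ᵇ toℕ j) (allFin n))) (allFin n)

edges : {n : ℕ} → Adj n → List (Edge n)
edges {n} A = filterᵇ (λ e → A (Data.Product.proj₁ e) (Data.Product.proj₂ e)) (pairs n)

numEdges : {n : ℕ} → Adj n → ℕ
numEdges A = length (edges A)

reach : {n : ℕ} → Adj n → ℕ → Fin n → Fin n → Bool
reach A zero u v = u == v
reach {n} A (suc k) u v = reach A k u v ∨ any (λ w → reach A k u w ∧ A w v) (allFin n)

-- u and v lie in the same connected component (walks of length ≤ n suffice)
linked : {n : ℕ} → Adj n → Fin n → Fin n → Bool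
linked {n} A u v = reach A n u v

connected : {n : ℕ} → Adj n → Bool
connected {n} A = all (λ u → all (λ v → linked A u v) (allFin n)) (allFin n)

remove : {n : ℕ} → Adj n → Edge n → Adj n
remove A (i , j) x y = A x y ∧ not ((x == i ∧ y == j) ∨ (x == j ∧ y == i))

-- spanning subgraph with exactly two components, one containing s, the other t
isSplit : {n : ℕ} → Adj n → Fin n → Fin n → Bool
isSplit {n} A s t = not (linked A s t) ∧ all (λ v → linked A s v ∨ linked A t v) (allFin n)

-- F_1: number of split subgraphs with m-1 edges, i.e. edges whose deletion gives a split subgraph
F1 : {n : ℕ} → Adj n → Fin n → Fin n → ℕ
F1 A s t = length (filterᵇ (λ e → isSplit (remove A e) s t) (edges A))

isBridge : {n : ℕ} → Adj n → Edge n → Bool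
isBridge A e = not (connected (remove A e))

numBridges : {n : ℕ} → Adj n → ℕ
numBridges A = length (filterᵇ (isBridge A) (edges A))

isSTCut : {n : ℕ} → Adj n → Fin n → Fin n → Edge n → Bool
isSTCut A s t e = not (linked (remove A e) s t)

IsMaxBridges : ℕ → ℕ → ℕ → Set
IsMaxBridges n m b =
  (Σ (SimpleGraph n) λ G → connected (adj G) ≡ true × numEdges (adj G) ≡ m × numBridges (adj G) ≡ b)
  × ((G : SimpleGraph n) → connected (adj G) ≡ true → numEdges (adj G) ≡ m → numBridges (adj G) ≤ b)

{-# OPTIONS --safe #-}
-- Deleting one edge from a connected graph leaves at most two components, each containing an
-- endpoint of the edge. Hence deleting e leaves a split subgraph exactly when e is an s-t cut,
-- and every s-t cut is a bridge: F₁(G) counts a subset of the bridges, so F₁(G) ≤ #bridges ≤ b,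
-- with equality iff #bridges = b and no bridge is missed, i.e. every bridge is an s-t cut.
module Submission where

open import Data.Bool using (Bool; true; false; T; not; _∧_; _∨_)
open import Data.Bool.Properties using (T-∧; T-∨; T-≡; ∧-comm; ∨-comm)
open import Data.Empty using (⊥-elim)
open import Data.Fin using (Fin)
open import Data.List using (List; allFin; filterᵇ; length)
open import Data.List.Membership.Propositional using (_∈_; lose)
open import Data.List.Membership.Propositional.Properties using (∈-filter⁺; ∈-filter⁻; ∈-allFin; ∈-length)
open import Data.List.Properties using (length-filter; length-tabulate; filter-all)
open import Data.List.Relation.Binary.Pointwise using (Pointwise-≡⇒≡)
open import Data.List.Relation.Binary.Sublist.Propositional using (_⊆_)
open import Data.List.Relation.Binary.Sublist.Propositional.Properties
  using (filter⁺; filter-⊆; length-mono-≤; to-≋)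
open import Data.List.Relation.Unary.All as All using (All)
open import Data.List.Relation.Unary.All.Properties using (all⁺; all⁻)
open import Data.List.Relation.Unary.Any using (satisfied)
open import Data.List.Relation.Unary.Any.Properties using (any⁺; any⁻)
open import Data.Nat using (ℕ; zero; suc; _≤_; _<_; s≤s)
open import Data.Nat.Combinatorics using (_C_)
open import Data.Nat.Properties using (≤-trans; ≤-reflexive; ≤-antisym; ≤⇒≯; m≤n⇒m<n∨m≡n)
open import Data.Product using (∃; _×_; _,_; proj₁; proj₂)
open import Data.Product.Function.NonDependent.Propositional using (_×-⇔_)
open import Data.Sum as Sum using (_⊎_; inj₁; inj₂)
open import Defs hiding (sym)
open import Function using (_∘_; _$_; id; _⇔_; mk⇔; Equivalence)
open import Function.Construct.Composition using (_⇔-∘_)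
open import Function.Construct.Identity using (⇔-id)
open import Level using (Level)
open import Relation.Binary.Definitions using (Reflexive; Symmetric; Transitive)
open import Relation.Binary.PropositionalEquality using (_≡_; _≢_; refl; sym; trans; cong; cong₂; subst)
open import Relation.Nullary using (¬_; yes; no)
open import Relation.Nullary.Decidable using (T?; toWitness; fromWitness)

open Equivalence using (to; from)

¬T⇒T-not : ∀ {b} → ¬ T b → T (not b)
¬T⇒T-not {false} _ = _
¬T⇒T-not {true}  ¬b = ¬b _

T-not⇒¬T : ∀ {b} → T (not b) → ¬ T b
T-not⇒¬T {false} _ ()

private
  variable
    a : Level
    A : Set a

_⇒[_]_ : (A → Bool) → List A → (A → Bool) → Set _
p ⇒[ xs ] q = ∀ {x} → x ∈ xs → T (p x) → T (q x)

filterᵇ-⊆ : ∀ {p q : A → Bool} {xs} → p ⇒[ xs ] q → filterᵇ p xs ⊆ filterᵇ q xs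
filterᵇ-⊆ {p = p} {q} {xs} p⇒q =
  -- filterᵇ p xs is its own filterᵇ q, and filterᵇ q is monotone for sublists
  subst (_⊆ filterᵇ q xs) (filter-all (T? ∘ q) {filterᵇ p xs} q-on-filterᵇ-p)
        (filter⁺ (T? ∘ q) (T? ∘ q) (λ { refl → id }) (filter-⊆ (T? ∘ p) xs))
  where
  q-on-filterᵇ-p : All (T ∘ q) (filterᵇ p xs)
  q-on-filterᵇ-p = All.tabulate λ x∈ →
    let x∈xs , px = ∈-filter⁻ (T? ∘ p) {xs = xs} x∈ in p⇒q x∈xs px

length-filterᵇ-mono : ∀ {p q : A → Bool} {xs} → p ⇒[ xs ] q →
                      length (filterᵇ p xs) ≤ length (filterᵇ q xs)
length-filterᵇ-mono = length-mono-≤ ∘ filterᵇ-⊆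

length-filterᵇ-≡⇒⊇ : ∀ {p q : A → Bool} {xs} → p ⇒[ xs ] q →
                      length (filterᵇ p xs) ≡ length (filterᵇ q xs) →
                      q ⇒[ xs ] p
length-filterᵇ-≡⇒⊇ {p = p} {q} {xs} p⇒q eq x∈xs qx =
  proj₂ $ ∈-filter⁻ (T? ∘ p) {xs = xs} $
  subst (_ ∈_) (sym (Pointwise-≡⇒≡ (to-≋ eq (filterᵇ-⊆ p⇒q)))) (∈-filter⁺ (T? ∘ q) x∈xs qx)

length-filterᵇ≡bound⇔ : ∀ {p q : A → Bool} {xs b} → p ⇒[ xs ] q → length (filterᵇ q xs) ≤ b →
                        length (filterᵇ p xs) ≡ b ⇔ (length (filterᵇ q xs) ≡ b × q ⇒[ xs ] p)
length-filterᵇ≡bound⇔ {p = p} {q} {xs} {b} p⇒q #q≤b = mk⇔ tight⇒ ⇒tight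
  where
  Tight : Set _
  Tight = length (filterᵇ q xs) ≡ b × q ⇒[ xs ] p

  tight⇒ : length (filterᵇ p xs) ≡ b → Tight
  tight⇒ #p≡b = #q≡b , length-filterᵇ-≡⇒⊇ p⇒q (trans #p≡b (sym #q≡b))
    where
    #q≡b : length (filterᵇ q xs) ≡ b
    #q≡b = ≤-antisym #q≤b (subst (_≤ _) #p≡b (length-filterᵇ-mono p⇒q))

  ⇒tight : Tight → length (filterᵇ p xs) ≡ b
  ⇒tight (#q≡b , q⇒p) = trans (≤-antisym (length-filterᵇ-mono p⇒q) (length-filterᵇ-mono q⇒p)) #q≡b

Adjacent : ∀ {n} → Adj n → Fin n → Fin n → Set
Adjacent A u v = T (A u v)

Linked : ∀ {n} → Adj n → Fin n → Fin n → Set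
Linked A u v = T (linked A u v)

-- Until it saturates, the set of vertices reachable in ≤ k steps strictly grows with k; it has
-- at most n elements, so it is saturated at k = n, which makes linked closed under edges.
module Reachability {n} (A : Adj n) (u : Fin n) where

  reach-suc⁺ : ∀ k → reach A k u ⇒[ allFin n ] reach A (suc k) u
  reach-suc⁺ k _ r = T-∨ .from (inj₁ r)

  reach-step : ∀ k {w v} → T (reach A k u w) → Adjacent A w v → T (reach A (suc k) u v)
  reach-step k {w} r a = T-∨ .from (inj₂ (any⁺ _ (lose (∈-allFin w) (T-∧ .from (r , a)))))

  reach-suc⁻ : ∀ k {v} → T (reach A (suc k) u v) →
               T (reach A k u v) ⊎ ∃ λ w → T (reach A k u w) × Adjacent A w v
  reach-suc⁻ k r with T-∨ .to r
  ... | inj₁ r′ = inj₁ r′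
  ... | inj₂ r′ with satisfied (any⁻ _ (allFin n) r′)
  ...   | w , r∧a = inj₂ (w , T-∧ .to r∧a)

  reach-refl : ∀ k → T (reach A k u u)
  reach-refl zero    = fromWitness refl
  reach-refl (suc k) = reach-suc⁺ k (∈-allFin u) (reach-refl k)

  reach-ind : (P : Fin n → Set) → P u → (∀ {w v} → P w → Adjacent A w v → P v) →
              ∀ k {v} → T (reach A k u v) → P v
  reach-ind P Pu step zero r = subst P (toWitness r) Pu
  reach-ind P Pu step (suc k) r with reach-suc⁻ k r
  ... | inj₁ r′ = reach-ind P Pu step k r′
  ... | inj₂ (w , r′ , a) = step (reach-ind P Pu step k r′) a

  Saturated : ℕ → Set
  Saturated k = ∀ {v} → T (reach A (suc k) u v) → T (reach A k u v)

  saturated-suc : ∀ k → Saturated k → Saturated (suc k)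
  saturated-suc k sat r with reach-suc⁻ (suc k) r
  ... | inj₁ r′ = r′
  ... | inj₂ (w , r′ , a) = reach-step k (sat r′) a

  reached : ℕ → ℕ
  reached k = length (filterᵇ (reach A k u) (allFin n))

  reached≤n : ∀ k → reached k ≤ n
  reached≤n k =
    ≤-trans (length-filter (T? ∘ reach A k u) (allFin n)) (≤-reflexive (length-tabulate _))

  growing-or-saturated : ∀ k → reached k < reached (suc k) ⊎ Saturated k
  growing-or-saturated k with m≤n⇒m<n∨m≡n (length-filterᵇ-mono (reach-suc⁺ k))
  ... | inj₁ rk<rsk = inj₁ rk<rsk
  ... | inj₂ rk≡rsk = inj₂ (length-filterᵇ-≡⇒⊇ (reach-suc⁺ k) rk≡rsk (∈-allFin _))

  saturated-or-growing : ∀ k → Saturated k ⊎ k < reached k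
  saturated-or-growing zero =
    inj₂ (∈-length (∈-filter⁺ (T? ∘ reach A 0 u) (∈-allFin u) (reach-refl 0)))
  saturated-or-growing (suc k) with saturated-or-growing k | growing-or-saturated k
  ... | inj₁ sat  | _           = inj₁ (saturated-suc k sat)
  ... | inj₂ _    | inj₂ sat    = inj₁ (saturated-suc k sat)
  ... | inj₂ k<rk | inj₁ rk<rsk = inj₂ (≤-trans (s≤s k<rk) rk<rsk)

  saturated-at-n : Saturated n
  saturated-at-n with saturated-or-growing n
  ... | inj₁ sat  = sat
  ... | inj₂ n<rn = ⊥-elim (≤⇒≯ (reached≤n n) n<rn)

module _ {n} (A : Adj n) where

  open Reachability A

  linked-step : ∀ {u w v} → Linked A u w → Adjacent A w v → Linked A u v
  linked-step {u} l a = saturated-at-n u (reach-step u n l a)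

  linked-ind : ∀ {u} (P : Fin n → Set) → P u → (∀ {w v} → P w → Adjacent A w v → P v) →
               ∀ {v} → Linked A u v → P v
  linked-ind {u} P Pu step = reach-ind u P Pu step n

  linked-refl : Reflexive (Linked A)
  linked-refl {u} = reach-refl u n

  linked-trans : Transitive (Linked A)
  linked-trans {u} luv = linked-ind (Linked A u) luv linked-step

  linked-sym : Symmetric (Adjacent A) → Symmetric (Linked A)
  linked-sym adj-sym {u} = linked-ind (λ v → Linked A v u) linked-refl
    λ lwu awv → linked-trans (linked-step linked-refl (adj-sym awv)) lwu

  connected⇒linked : T (connected A) → ∀ u v → Linked A u v
  connected⇒linked conn u v =
    All.lookup (all⁺ _ _ (All.lookup (all⁺ _ _ conn) (∈-allFin u))) (∈-allFin v)

adjacent-sym : ∀ {n} (G : SimpleGraph n) → Symmetric (Adjacent (adj G))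
adjacent-sym G {u} {v} = subst T (SimpleGraph.sym G u v)

removeEdge : ∀ {n} → SimpleGraph n → Edge n → SimpleGraph n
removeEdge G (i , j) = record
  { adj    = remove (adj G) (i , j)
  ; sym    = λ x y → cong₂ _∧_ (SimpleGraph.sym G x y) (cong not (trans
               (cong₂ _∨_ (∧-comm (x == i) (y == j)) (∧-comm (x == j) (y == i)))
               (∨-comm (y == j ∧ x == i) (y == i ∧ x == j))))
  ; irrefl = λ x → cong (_∧ _) (SimpleGraph.irrefl G x)
  }

module EdgeDeletion {n} (G : SimpleGraph n) (i j : Fin n) where

  A′ : Adj n
  A′ = adj (removeEdge G (i , j))

  kept-or-incident : ∀ {w v} → Adjacent (adj G) w v → Adjacent A′ w v ⊎ (v ≡ i ⊎ v ≡ j)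
  kept-or-incident {w} {v} a with T? ((w == i ∧ v == j) ∨ (w == j ∧ v == i))
  ... | no kept  = inj₁ (T-∧ .from (a , ¬T⇒T-not kept))
  ... | yes lost with T-∨ .to lost
  ...   | inj₁ wi∧vj = inj₂ (inj₂ (toWitness (proj₂ (T-∧ {w == i} .to wi∧vj))))
  ...   | inj₂ wj∧vi = inj₂ (inj₁ (toWitness (proj₂ (T-∧ {w == j} .to wj∧vi))))

  module _ (conn : T (connected (adj G))) where

    linked-to-endpoint : ∀ v → Linked A′ v i ⊎ Linked A′ v j
    linked-to-endpoint v =
      linked-ind (adj G) P (inj₁ (linked-refl A′)) step (connected⇒linked (adj G) conn i v)
      where
      P : Fin n → Set
      P x = Linked A′ x i ⊎ Linked A′ x j
      step : ∀ {w v} → P w → Adjacent (adj G) w v → P v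
      step Pw a with kept-or-incident a
      ... | inj₁ a′ = Sum.map (linked-trans A′ lvw) (linked-trans A′ lvw) Pw
        where lvw = linked-step A′ (linked-refl A′) (adjacent-sym (removeEdge G (i , j)) a′)
      ... | inj₂ (inj₁ refl) = inj₁ (linked-refl A′)
      ... | inj₂ (inj₂ refl) = inj₂ (linked-refl A′)

    linked-through : ∀ {x y z} → Linked A′ x z → Linked A′ y z → Linked A′ x y
    linked-through xz yz = linked-trans A′ xz (linked-sym A′ (adjacent-sym (removeEdge G (i , j))) yz)

    at-most-two-components : ∀ {a b} → ¬ Linked A′ a b → ∀ c → Linked A′ a c ⊎ Linked A′ b c
    at-most-two-components {a} {b} ¬ab c
      with linked-to-endpoint a | linked-to-endpoint b | linked-to-endpoint c
    ... | inj₁ ai | inj₁ bi | _       = ⊥-elim (¬ab (linked-through ai bi))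
    ... | inj₂ aj | inj₂ bj | _       = ⊥-elim (¬ab (linked-through aj bj))
    ... | inj₁ ai | inj₂ _  | inj₁ ci = inj₁ (linked-through ai ci)
    ... | inj₁ _  | inj₂ bj | inj₂ cj = inj₂ (linked-through bj cj)
    ... | inj₂ aj | inj₁ _  | inj₂ cj = inj₁ (linked-through aj cj)
    ... | inj₂ _  | inj₁ bi | inj₁ ci = inj₂ (linked-through bi ci)

module _ {n} (A : Adj n) (s t : Fin n) where

  split⇒stCut : ∀ e → T (isSplit (remove A e) s t) → T (isSTCut A s t e)
  split⇒stCut e = proj₁ ∘ T-∧ .to

  stCut⇒bridge : ∀ e → T (isSTCut A s t e) → T (isBridge A e)
  stCut⇒bridge e cut = ¬T⇒T-not λ conn → T-not⇒¬T cut (connected⇒linked (remove A e) conn s t)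

stCut⇒split : ∀ {n} (G : SimpleGraph n) → T (connected (adj G)) → ∀ s t e →
              T (isSTCut (adj G) s t e) → T (isSplit (remove (adj G) e) s t)
stCut⇒split G conn s t (i , j) cut =
  T-∧ .from (cut , all⁻ _ {allFin _} (All.universal two-sides _))
  where
  open EdgeDeletion G i j
  two-sides : ∀ v → T (linked A′ s v ∨ linked A′ t v)
  two-sides v = T-∨ .from (at-most-two-components conn (T-not⇒¬T cut) v)

lemma5 : (n m b : ℕ) → 4 ≤ n → n ≤ m → m ≤ n C 2 → IsMaxBridges n m b →
         (G : SimpleGraph n) → connected (adj G) ≡ true → numEdges (adj G) ≡ m →
         (s t : Fin n) → s ≢ t →
         (F1 (adj G) s t ≤ b)
         × (F1 (adj G) s t ≡ b ⇔
             (numBridges (adj G) ≡ b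
              × (∀ e → e ∈ edges (adj G) → isBridge (adj G) e ≡ true → isSTCut (adj G) s t e ≡ true)))
lemma5 n m b _ _ _ (_ , max-bridges) G conn em s t _ =
  ≤-trans (length-filterᵇ-mono split⇒bridge) #bridges≤b ,
  (⇔-id _ ×-⇔ bridges-split⇔bridges-cut) ⇔-∘ length-filterᵇ≡bound⇔ split⇒bridge #bridges≤b
  where
  split : Edge n → Bool
  split e = isSplit (remove (adj G) e) s t

  split⇒bridge : split ⇒[ edges (adj G) ] isBridge (adj G)
  split⇒bridge {e} _ = stCut⇒bridge (adj G) s t e ∘ split⇒stCut (adj G) s t e

  #bridges≤b : numBridges (adj G) ≤ b
  #bridges≤b = max-bridges G conn em

  bridges-split⇔bridges-cut : isBridge (adj G) ⇒[ edges (adj G) ] split ⇔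
                              (∀ e → e ∈ edges (adj G) → isBridge (adj G) e ≡ true → isSTCut (adj G) s t e ≡ true)
  bridges-split⇔bridges-cut = mk⇔
    (λ h e e∈ br → T-≡ .to (split⇒stCut (adj G) s t e (h e∈ (T-≡ .from br))))
    (λ h {e} e∈ br → stCut⇒split G (T-≡ .from conn) s t e (T-≡ .from (h e e∈ (T-≡ .to br))))
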